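{- Let $T$ be a tree on $t$ vertices and let $G$ be a bipartite graph with parts $X$ and $Y$ having at least one edge. Assume that for every edge $xy\in E(G)$ with $x\in X$ and $y\in Y$, the vertex $y$ has at least $t$ neighbours $z$ with $d(\{x,z\})\ge t$. Then $G$ contains $K_2\,\square\,T$ as a subgraph.
   Context: For a set $S$ of vertices, $d(S)$ is the number of common neighbours of all vertices of $S$ (for $S=\{x,z\}$ with $x=z$ this is the degree of $x$). The Cartesian product $G\,\square\,H$ has vertex set $V(G)\times V(H)$, with $(g_1,h_1)$ adjacent to $(g_2,h_2)$ iff either $g_1=g_2$ and $h_1h_2\in E(H)$, or $h_1=h_2$ and $g_1g_2\in E(G)$; $K_2$ is a single edge. -}

module Defs where

open import Data.Nat using (ℕ; suc; _≤_; _≤ᵇ_)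
open import Data.Bool using (Bool; true; false; _∧_; if_then_else_)
open import Data.Fin using (Fin)
open import Data.Fin.Properties using (_≟_)
open import Data.List using (List; []; _∷_; length; filter; allFin)
open import Data.List.Relation.Unary.Unique.Propositional using (Unique)
open import Data.Product using (_×_; _,_; Σ; ∃; ∃-syntax)
open import Data.Sum using (_⊎_)
open import Relation.Binary.PropositionalEquality using (_≡_)
open import Relation.Nullary using (¬_)
open import Relation.Nullary.Decidable using (⌊_⌋)
open import Function.Definitions using (Injective)

record Graph (n : ℕ) : Set where
  field
    adj   : Fin n → Fin n → Bool
    sym   : ∀ u v → adj u v ≡ adj v u
    irref : ∀ v → adj v v ≡ false
open Graph public

Adj : ∀ {n} → Graph n → Fin n → Fin n → Set
Adj G u v = adj G u v ≡ true

countV : ∀ {n} → (Fin n → Bool) → ℕ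
countV {n} p = length (filter (λ w → p w ≟ᵇ true) (allFin n))
  where
  open import Data.Bool.Properties using () renaming (_≟_ to _≟ᵇ_)

-- d({x,z}) : number of common neighbours of x and z (degree of x if x = z)
d₂ : ∀ {n} → Graph n → Fin n → Fin n → ℕ
d₂ G x z = countV (λ w → adj G x w ∧ adj G z w)

goodNbrs : ∀ {n} → Graph n → ℕ → Fin n → Fin n → ℕ
goodNbrs G t x y = countV (λ z → adj G y z ∧ (t ≤ᵇ d₂ G x z))

HasEdge : ∀ {n} → Graph n → Set
HasEdge G = ∃[ u ] ∃[ v ] Adj G u v

-- Bipartition of G into X = {v | side v ≡ false}, Y = {v | side v ≡ true}:
-- every edge joins a vertex of X to a vertex of Y.
IsBipartition : ∀ {n} → Graph n → (Fin n → Bool) → Set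
IsBipartition G side = ∀ u v → Adj G u v → ¬ (side u ≡ side v)

data Walk {n} (G : Graph n) : Fin n → Fin n → Set where
  here : ∀ {v} → Walk G v v
  step : ∀ {u w v} → Adj G u w → Walk G w v → Walk G u v

Connected : ∀ {n} → Graph n → Set
Connected G = ∀ u v → Walk G u v

data PathFrom {n} (G : Graph n) : Fin n → List (Fin n) → Fin n → Set where
  end  : ∀ {v} → PathFrom G v [] v
  cons : ∀ {u w vs v} → Adj G u w → PathFrom G w vs v → PathFrom G u (w ∷ vs) v

-- A cycle: distinct vertices v₀, v₁, …, v_k (k ≥ 2, so at least 3 vertices),
-- consecutive ones adjacent, and v_k adjacent to v₀.
HasCycle : ∀ {n} → Graph n → Set
HasCycle {n} G =
  ∃[ v₀ ] ∃[ vs ] ∃[ vₖ ]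
    (2 ≤ length vs × Unique (v₀ ∷ vs) × PathFrom G v₀ vs vₖ × Adj G vₖ v₀)

IsTree : ∀ {n} → Graph n → Set
IsTree G = Connected G × ¬ HasCycle G

-- Adjacency of the Cartesian product K₂ □ T on vertex set Fin 2 × Fin t
-- (Fin 2 is the vertex set of K₂, whose two distinct vertices are adjacent).
K₂□Adj : ∀ {t} → Graph t → (Fin 2 × Fin t) → (Fin 2 × Fin t) → Set
K₂□Adj T (a , h₁) (b , h₂) =
  (a ≡ b × Adj T h₁ h₂) ⊎ (h₁ ≡ h₂ × ¬ (a ≡ b))

ContainsK₂□ : ∀ {n t} → Graph n → Graph t → Set
ContainsK₂□ {n} {t} G T =
  Σ (Fin 2 × Fin t → Fin n) λ f →
    Injective _≡_ _≡_ f × (∀ p q → K₂□Adj T p q → Adj G (f p) (f q))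

module Submission where

-- Each tree vertex v is sent to a rung: an edge x_v y_v of G with x_v ∈ X and y_v ∈ Y, such that
-- x_u y_v and x_v y_u are edges whenever uv is a tree edge.  The rungs are chosen greedily, adding
-- the tree vertices so that the embedded set stays connected; as T is acyclic, a new vertex v then
-- has a single embedded neighbour u.  Fewer than t vertices are in use on either side, so y_u has an
-- unused neighbour z with d({x_u, z}) ≥ t, and x_u, z have an unused common neighbour y′; the rung
-- x_v y_v := z y′ fits.  Finally a proper 2-colouring of T decides, for each v, which of x_v, y_v
-- is the copy of v in the first layer of K₂ □ T, so that each layer alternates between X and Y
-- along every tree edge.

open import Defs hiding (sym)
open import Data.Nat using (ℕ; zero; suc; _≤_; _<_; _+_; s≤s; z≤n)
open import Data.Nat.Properties using (≤ᵇ⇒≤; <⇒≱; ≤-refl; ≤-trans; +-identityʳ; +-suc)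
open import Data.Bool using (Bool; true; false; _∧_; not)
open import Data.Bool.Properties using (¬-not; T-≡) renaming (_≟_ to _≟ᵇ_)
open import Data.Fin using (Fin; opposite)
open import Data.Fin.Properties using (_≟_; injective⇒≤; any?; all?; ¬∀⟶∃¬)
open import Data.List using (List; []; _∷_; [_]; _++_; length; lookup; allFin; map)
open import Data.List.Properties using (length-map)
open import Data.List.Relation.Unary.Any using (here; there; index)
open import Data.List.Relation.Unary.Any.Properties using (lookup-index)
open import Data.List.Relation.Unary.All as All using (All; []; _∷_)
open import Data.List.Relation.Unary.All.Properties using (¬Any⇒All¬) renaming (++⁺ to All-++⁺)
open import Data.List.Relation.Unary.AllPairs using ([]; _∷_)
open import Data.List.Relation.Unary.Unique.Propositional using (Unique)
open import Data.List.Relation.Unary.Unique.Propositional.Properties using (filter⁺; allFin⁺) renaming (++⁺ to Unique-++⁺)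
open import Data.List.Membership.Propositional using (_∈_; _∉_)
open import Data.List.Membership.Propositional.Properties using (∈-lookup; ∈-filter⁻; ∈-map⁺)
open import Data.List.Relation.Binary.Subset.Propositional using (_⊆_)
open import Data.Product using (_×_; _,_; ∃-syntax; ∃₂; proj₂)
open import Data.Sum using (inj₁; inj₂)
open import Function using (_∘_; const)
open import Data.Vec.Functional using (updateAt)
open import Data.Vec.Functional.Properties using (updateAt-updates; updateAt-minimal)
open import Function.Bundles using (Equivalence)
open import Relation.Nullary using (¬_; Dec; yes; no; ¬?; contradiction)
open import Relation.Nullary.Decidable using (_×-dec_; decidable-stable)
open import Relation.Binary.PropositionalEquality using (_≡_; _≢_; refl; sym; trans; cong; subst; module ≡-Reasoning)

unique-lookup-injective : ∀ {A : Set} {xs : List A} → Unique xs →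
                          ∀ {i j} → lookup xs i ≡ lookup xs j → i ≡ j
unique-lookup-injective (_ ∷ _) {Fin.zero} {Fin.zero} _ = refl
unique-lookup-injective {xs = _ ∷ xs} (x∉ ∷ _) {Fin.zero} {Fin.suc j} eq =
  contradiction eq (All.lookup x∉ (∈-lookup {xs = xs} j))
unique-lookup-injective {xs = _ ∷ xs} (x∉ ∷ _) {Fin.suc i} {Fin.zero} eq =
  contradiction (sym eq) (All.lookup x∉ (∈-lookup {xs = xs} i))
unique-lookup-injective (_ ∷ u) {Fin.suc i} {Fin.suc j} eq =
  cong Fin.suc (unique-lookup-injective u eq)

unique-⊆⇒length≤ : ∀ {A : Set} {xs ys : List A} → Unique xs → xs ⊆ ys → length xs ≤ length ys
unique-⊆⇒length≤ {xs = xs} {ys} u xs⊆ys = injective⇒≤ position-injective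
  where
  position : Fin (length xs) → Fin (length ys)
  position i = index (xs⊆ys (∈-lookup i))

  position-injective : ∀ {i j} → position i ≡ position j → i ≡ j
  position-injective {i} {j} eq = unique-lookup-injective u (begin
    lookup xs i                  ≡⟨ lookup-index (xs⊆ys (∈-lookup i)) ⟩
    lookup ys (position i)       ≡⟨ cong (lookup ys) eq ⟩
    lookup ys (position j)       ≡⟨ sym (lookup-index (xs⊆ys (∈-lookup j))) ⟩
    lookup xs j                  ∎)
    where open ≡-Reasoning

∉⇒All≢ : ∀ {A : Set} {v : A} {S xs} → v ∉ S → All (_∈ S) xs → All (v ≢_) xs
∉⇒All≢ v∉ = All.map λ { x∈ refl → v∉ x∈ }

∉-map⇒≢ : ∀ {A B : Set} {f : A → B} {y x xs} → y ∉ map f xs → x ∈ xs → y ≢ f x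
∉-map⇒≢ y∉ x∈ refl = y∉ (∈-map⁺ _ x∈)

∧-true⁻ : ∀ {a b} → a ∧ b ≡ true → a ≡ true × b ≡ true
∧-true⁻ {true} {true} _ = refl , refl

opposite-≢ : ∀ (a : Fin 2) → opposite a ≢ a
opposite-≢ Fin.zero ()
opposite-≢ (Fin.suc Fin.zero) ()

≢-≢⇒≡ : ∀ {a b c : Fin 2} → a ≢ b → b ≢ c → a ≡ c
≢-≢⇒≡ {Fin.zero} {Fin.zero} a≢b _ = contradiction refl a≢b
≢-≢⇒≡ {Fin.zero} {Fin.suc Fin.zero} {Fin.zero} _ _ = refl
≢-≢⇒≡ {Fin.zero} {Fin.suc Fin.zero} {Fin.suc Fin.zero} _ b≢c = contradiction refl b≢c
≢-≢⇒≡ {Fin.suc Fin.zero} {Fin.zero} {Fin.zero} _ b≢c = contradiction refl b≢c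
≢-≢⇒≡ {Fin.suc Fin.zero} {Fin.zero} {Fin.suc Fin.zero} _ _ = refl
≢-≢⇒≡ {Fin.suc Fin.zero} {Fin.suc Fin.zero} a≢b _ = contradiction refl a≢b

module _ {n : ℕ} where

  open import Data.List.Membership.DecPropositional (_≟_ {n}) using (_∈?_)

  unique⇒length≤ : {xs : List (Fin n)} → Unique xs → length xs ≤ n
  unique⇒length≤ u = injective⇒≤ (unique-lookup-injective u)

  ∉⇒length< : ∀ {v} {xs : List (Fin n)} → Unique xs → v ∉ xs → length xs < n
  ∉⇒length< {xs = xs} u v∉ = unique⇒length≤ (¬Any⇒All¬ xs v∉ ∷ u)

  countV≤ : (p : Fin n → Bool) (L : List (Fin n)) → (∀ {w} → p w ≡ true → w ∈ L) → countV p ≤ length L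
  countV≤ p L p⊆L = unique-⊆⇒length≤ (filter⁺ P? (allFin⁺ n))
    (p⊆L ∘ proj₂ ∘ ∈-filter⁻ P? {xs = allFin n})
    where
    P? : ∀ w → Dec (p w ≡ true)
    P? w = p w ≟ᵇ true

  countV-avoid : (p : Fin n → Bool) (L : List (Fin n)) → length L < countV p →
                 ∃[ w ] (p w ≡ true × w ∉ L)
  countV-avoid p L L<p with any? (λ w → (p w ≟ᵇ true) ×-dec ¬? (w ∈? L))
  ... | yes found = found
  ... | no none = contradiction (countV≤ p L p⊆L) (<⇒≱ L<p)
    where
    p⊆L : ∀ {w} → p w ≡ true → w ∈ L
    p⊆L {w} pw = decidable-stable (w ∈? L) (λ w∉ → none (w , pw , w∉))

module _ {n : ℕ} (G : Graph n) where

  adj-sym : ∀ {u v} → Adj G u v → Adj G v u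
  adj-sym {u} {v} e = trans (Graph.sym G v u) e

  adj-irrefl : ∀ {v} → ¬ Adj G v v
  adj-irrefl {v} e = contradiction (trans (sym (irref G v)) e) λ ()

  bipartition-flips : ∀ {side} → IsBipartition G side → ∀ {u v} → Adj G u v → side v ≡ not (side u)
  bipartition-flips bip {u} {v} e = ¬-not (bip v u (adj-sym e))

  square-avoiding : ∀ {t x y} (Lx Ly : List (Fin n)) → t ≤ goodNbrs G t x y →
                    length Lx < t → length Ly < t →
                    ∃₂ λ z y′ → z ∉ Lx × y′ ∉ Ly × Adj G y z × Adj G x y′ × Adj G z y′
  square-avoiding {t} {x} {y} Lx Ly good Lx<t Ly<t =
    let z , z-good , z∉ = countV-avoid _ Lx (≤-trans Lx<t good)
        y-z , t≤d = ∧-true⁻ z-good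
        y′ , y′-common , y′∉ = countV-avoid _ Ly (≤-trans Ly<t (≤ᵇ⇒≤ t _ (Equivalence.from T-≡ t≤d)))
        x-y′ , z-y′ = ∧-true⁻ y′-common
    in z , y′ , z∉ , y′∉ , y-z , x-y′ , z-y′

module _ {t : ℕ} (H : Graph t) where

  open import Data.List.Membership.DecPropositional (_≟_ {t}) using (_∈?_)

  PathWithin : List (Fin t) → Fin t → Fin t → Set
  PathWithin S u u′ = ∃[ vs ] (Unique (u ∷ vs) × PathFrom H u vs u′ × All (_∈ S) vs)

  InducedConnected : List (Fin t) → Set
  InducedConnected S = ∀ {u u′} → u ∈ S → u′ ∈ S → u ≢ u′ → PathWithin S u u′

  singleton-inducedConnected : ∀ {r} → InducedConnected [ r ]
  singleton-inducedConnected (here refl) (here refl) r≢r = contradiction refl r≢r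

  pathFrom-snoc : ∀ {a vs b c} → PathFrom H a vs b → Adj H b c → PathFrom H a (vs ++ [ c ]) c
  pathFrom-snoc end e = cons e end
  pathFrom-snoc (cons e′ p) e = cons e′ (pathFrom-snoc p e)

  ∷-inducedConnected : ∀ {S u v} → InducedConnected S → u ∈ S → v ∉ S → Adj H u v →
                       InducedConnected (v ∷ S)
  ∷-inducedConnected conn u∈ v∉ u-v (here refl) (here refl) v≢v = contradiction refl v≢v
  ∷-inducedConnected {u = u} conn u∈ v∉ u-v {u′ = w} (here refl) (there w∈) _ with w ≟ u
  ... | yes refl = [ u ] , (∉⇒All≢ v∉ (u∈ ∷ []) ∷ [] ∷ []) , cons (adj-sym H u-v) end , there u∈ ∷ []
  ... | no w≢u with conn u∈ w∈ (w≢u ∘ sym)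
  ... | vs , uniq , p , vs⊆S =
    u ∷ vs , ∉⇒All≢ v∉ (u∈ ∷ vs⊆S) ∷ uniq , cons (adj-sym H u-v) p , All.map there (u∈ ∷ vs⊆S)
  ∷-inducedConnected {u = u} conn u∈ v∉ u-v {u = w} (there w∈) (here refl) w≢v with w ≟ u
  ... | yes refl = [ _ ] , ((w≢v ∷ []) ∷ [] ∷ []) , cons u-v end , here refl ∷ []
  ... | no w≢u with conn w∈ u∈ w≢u
  ... | vs , uniq , p , vs⊆S =
    vs ++ [ _ ] , Unique-++⁺ uniq ([] ∷ []) v-fresh , pathFrom-snoc p u-v ,
    All-++⁺ (All.map there vs⊆S) (here refl ∷ [])
    where
    v-fresh : ∀ {x} → ¬ (x ∈ w ∷ vs × x ∈ [ _ ])
    v-fresh (x∈ , here refl) = v∉ (All.lookup (w∈ ∷ vs⊆S) x∈)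
  ∷-inducedConnected conn u∈ v∉ u-v (there w∈) (there w′∈) w≢w′ =
    let vs , uniq , p , vs⊆S = conn w∈ w′∈ w≢w′ in vs , uniq , p , All.map there vs⊆S

  acyclic⇒unique-neighbour : ¬ HasCycle H → ∀ {S u v} → InducedConnected S → v ∉ S → u ∈ S → Adj H u v →
                             ∀ {w} → w ∈ S → Adj H w v → w ≡ u
  acyclic⇒unique-neighbour acyclic {u = u} {v} conn v∉ u∈ u-v {w} w∈ w-v with w ≟ u
  ... | yes w≡u = w≡u
  ... | no w≢u with conn u∈ w∈ (w≢u ∘ sym)
  ... | [] , _ , end , _ = contradiction refl w≢u
  ... | vs@(_ ∷ _) , uniq , p , vs⊆S =
    contradiction (v , u ∷ vs , w , s≤s (s≤s z≤n) , ∉⇒All≢ v∉ (u∈ ∷ vs⊆S) ∷ uniq , cons (adj-sym H u-v) p , w-v)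
                  acyclic

  walk-exits : ∀ {S a c} → Walk H a c → a ∈ S → c ∉ S → ∃₂ λ u w → u ∈ S × w ∉ S × Adj H u w
  walk-exits here a∈ c∉ = contradiction a∈ c∉
  walk-exits {S} (step {w = w} a-w rest) a∈ c∉ with w ∈? S
  ... | yes w∈ = walk-exits rest w∈ c∉
  ... | no w∉ = _ , w , a∈ , w∉ , a-w

record Rung (n : ℕ) : Set where
  constructor rung
  field
    inX inY : Fin n
    colour  : Fin 2

open Rung

module _ {t n : ℕ} (T : Graph t) (G : Graph n) (side : Fin n → Bool) where

  record Ladder (S : List (Fin t)) (φ : Fin t → Rung n) : Set where
    field
      inX-side      : ∀ {v} → v ∈ S → side (inX (φ v)) ≡ false
      inY-side      : ∀ {v} → v ∈ S → side (inY (φ v)) ≡ true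
      rung-edge     : ∀ {v} → v ∈ S → Adj G (inX (φ v)) (inY (φ v))
      rail-edge     : ∀ {u v} → u ∈ S → v ∈ S → Adj T u v → Adj G (inX (φ u)) (inY (φ v))
      colour-proper : ∀ {u v} → u ∈ S → v ∈ S → Adj T u v → colour (φ u) ≢ colour (φ v)
      inX-injective : ∀ {u v} → u ∈ S → v ∈ S → inX (φ u) ≡ inX (φ v) → u ≡ v
      inY-injective : ∀ {u v} → u ∈ S → v ∈ S → inY (φ u) ≡ inY (φ v) → u ≡ v

  ladder-embedding : (Fin t → Rung n) → Fin 2 × Fin t → Fin n
  ladder-embedding φ (i , v) with i ≟ colour (φ v)
  ... | yes _ = inX (φ v)
  ... | no _  = inY (φ v)

  spanning-ladder⇒K₂□ : ∀ {S φ} → (∀ v → v ∈ S) → Ladder S φ → ContainsK₂□ G T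
  spanning-ladder⇒K₂□ {S} {φ} spans L = ladder-embedding φ , injective , preserves-edges
    where
    open Ladder L
    f : Fin 2 × Fin t → Fin n
    f = ladder-embedding φ

    inX≢inY : ∀ u v → inX (φ u) ≢ inY (φ v)
    inX≢inY u v eq =
      contradiction (trans (sym (inX-side (spans u))) (trans (cong side eq) (inY-side (spans v)))) λ ()

    injective : ∀ {p q} → f p ≡ f q → p ≡ q
    injective {i , u} {j , v} eq with i ≟ colour (φ u) | j ≟ colour (φ v)
    ... | yes i≡ | yes j≡ with inX-injective (spans u) (spans v) eq
    ...   | refl = cong (_, u) (trans i≡ (sym j≡))
    injective {i , u} {j , v} eq | yes _ | no _  = contradiction eq (inX≢inY u v)
    injective {i , u} {j , v} eq | no _  | yes _ = contradiction (sym eq) (inX≢inY v u)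
    injective {i , u} {j , v} eq | no i≢ | no j≢ with inY-injective (spans u) (spans v) eq
    ...   | refl = cong (_, u) (≢-≢⇒≡ i≢ (j≢ ∘ sym))

    preserves-edges : ∀ p q → K₂□Adj T p q → Adj G (f p) (f q)
    preserves-edges (i , u) (.i , v) (inj₁ (refl , u-v)) with i ≟ colour (φ u) | i ≟ colour (φ v)
    ... | yes i≡ | yes i≡′ = contradiction (trans (sym i≡) i≡′) (colour-proper (spans u) (spans v) u-v)
    ... | yes _  | no _    = rail-edge (spans u) (spans v) u-v
    ... | no _   | yes _   = adj-sym G (rail-edge (spans v) (spans u) (adj-sym T u-v))
    ... | no i≢  | no i≢′  = contradiction (≢-≢⇒≡ (i≢ ∘ sym) i≢′) (colour-proper (spans u) (spans v) u-v)
    preserves-edges (i , u) (j , .u) (inj₂ (refl , i≢j)) with i ≟ colour (φ u) | j ≟ colour (φ u)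
    ... | yes i≡ | yes j≡ = contradiction (trans i≡ (sym j≡)) i≢j
    ... | yes _  | no _   = rung-edge (spans u)
    ... | no _   | yes _  = adj-sym G (rung-edge (spans u))
    ... | no i≢  | no j≢  = contradiction (≢-≢⇒≡ i≢ (j≢ ∘ sym)) i≢j

  record FreshRung (S : List (Fin t)) (φ : Fin t → Rung n) (u : Fin t) (r : Rung n) : Set where
    field
      inX-side     : side (inX r) ≡ false
      inY-side     : side (inY r) ≡ true
      rung-edge    : Adj G (inX r) (inY r)
      to-parent    : Adj G (inX r) (inY (φ u))
      from-parent  : Adj G (inX (φ u)) (inY r)
      colour-flips : colour r ≢ colour (φ u)
      inX-fresh    : inX r ∉ map (inX ∘ φ) S
      inY-fresh    : inY r ∉ map (inY ∘ φ) S

  module _ {S φ u v r} (L : Ladder S φ) (v∉ : v ∉ S)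
           (parent : ∀ {w} → w ∈ S → Adj T w v → w ≡ u) (fresh : FreshRung S φ u r) where

    private
      φ′ : Fin t → Rung n
      φ′ = updateAt φ v (const r)
      open Ladder L
      module F = FreshRung fresh

      at-new : φ′ v ≡ r
      at-new = updateAt-updates v φ

      at-old : ∀ {w} → w ∈ S → φ′ w ≡ φ w
      at-old w∈ = updateAt-minimal _ v φ λ { refl → v∉ w∈ }

      lift : (P : Fin t → Rung n → Set) → P v r → (∀ {w} → w ∈ S → P w (φ w)) →
             ∀ {w} → w ∈ v ∷ S → P w (φ′ w)
      lift P new old (here refl) = subst (P v) (sym at-new) new
      lift P new old (there w∈)  = subst (P _) (sym (at-old w∈)) (old w∈)

      lift₂ : (R : Fin t → Rung n → Fin t → Rung n → Set) → R v r v r →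
              (∀ {w} → w ∈ S → R v r w (φ w)) → (∀ {w} → w ∈ S → R w (φ w) v r) →
              (∀ {w w′} → w ∈ S → w′ ∈ S → R w (φ w) w′ (φ w′)) →
              ∀ {w w′} → w ∈ v ∷ S → w′ ∈ v ∷ S → R w (φ′ w) w′ (φ′ w′)
      lift₂ R new-new new-old old-new old-old {w} {w′} w∈ w′∈ =
        lift (λ w ρ → R w ρ w′ (φ′ w′)) (lift (R v r) new-new new-old w′∈)
          (λ w∈ → lift (R _ (φ _)) (old-new w∈) (old-old w∈) w′∈) w∈

    graft : Ladder (v ∷ S) (updateAt φ v (const r))
    graft = record
      { inX-side      = lift (λ _ ρ → side (inX ρ) ≡ false) F.inX-side inX-side
      ; inY-side      = lift (λ _ ρ → side (inY ρ) ≡ true) F.inY-side inY-side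
      ; rung-edge     = lift (λ _ ρ → Adj G (inX ρ) (inY ρ)) F.rung-edge rung-edge
      ; rail-edge     = lift₂ (λ w ρ w′ σ → Adj T w w′ → Adj G (inX ρ) (inY σ)) absurd-loop
                          (λ w∈ v-w → at-parent (λ w → Adj G (inX r) (inY (φ w))) F.to-parent
                                                   w∈ (adj-sym T v-w))
                          (at-parent (λ w → Adj G (inX (φ w)) (inY r)) F.from-parent) rail-edge
      ; colour-proper = lift₂ (λ w ρ w′ σ → Adj T w w′ → colour ρ ≢ colour σ) absurd-loop
                          (λ w∈ v-w → at-parent (λ w → colour r ≢ colour (φ w)) F.colour-flips
                                                   w∈ (adj-sym T v-w))
                          (at-parent (λ w → colour (φ w) ≢ colour r) (F.colour-flips ∘ sym)) colour-proper
      ; inX-injective = lift₂ (λ w ρ w′ σ → inX ρ ≡ inX σ → w ≡ w′) (λ _ → refl)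
                          (λ w∈ eq → contradiction eq (∉-map⇒≢ F.inX-fresh w∈))
                          (λ w∈ eq → contradiction (sym eq) (∉-map⇒≢ F.inX-fresh w∈)) inX-injective
      ; inY-injective = lift₂ (λ w ρ w′ σ → inY ρ ≡ inY σ → w ≡ w′) (λ _ → refl)
                          (λ w∈ eq → contradiction eq (∉-map⇒≢ F.inY-fresh w∈))
                          (λ w∈ eq → contradiction (sym eq) (∉-map⇒≢ F.inY-fresh w∈)) inY-injective
      }
      where
      absurd-loop : ∀ {A : Set} → Adj T v v → A
      absurd-loop v-v = contradiction v-v (adj-irrefl T)

      at-parent : (P : Fin t → Set) → P u → ∀ {w} → w ∈ S → Adj T w v → P w
      at-parent P Pu w∈ w-v = subst P (sym (parent w∈ w-v)) Pu

module _ {n : ℕ} {G : Graph n} {side : Fin n → Bool} (bip : IsBipartition G side) where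

  oriented-edge : ∀ {a b} → Adj G a b → ∃₂ λ x y → side x ≡ false × side y ≡ true × Adj G x y
  oriented-edge {a} {b} a-b with side a in side-a
  ... | false = a , b , side-a , trans (bipartition-flips G bip a-b) (cong not side-a) , a-b
  ... | true  = b , a , trans (bipartition-flips G bip a-b) (cong not side-a) , side-a , adj-sym G a-b

  module _ {t : ℕ} (T : Graph t) where

    single-rung-ladder : ∀ {x y v c} → side x ≡ false → side y ≡ true → Adj G x y →
                         Ladder T G side [ v ] (const (rung x y c))
    single-rung-ladder x∈X y∈Y x-y = record
      { inX-side      = λ { (here refl) → x∈X }
      ; inY-side      = λ { (here refl) → y∈Y }
      ; rung-edge     = λ { (here refl) → x-y }
      ; rail-edge     = λ { (here refl) (here refl) v-v → contradiction v-v (adj-irrefl T) }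
      ; colour-proper = λ { (here refl) (here refl) v-v → contradiction v-v (adj-irrefl T) }
      ; inX-injective = λ { (here refl) (here refl) _ → refl }
      ; inY-injective = λ { (here refl) (here refl) _ → refl }
      }

    module _ (dense : ∀ x y → side x ≡ false → side y ≡ true → Adj G x y → t ≤ goodNbrs G t x y) where

      fresh-rung : ∀ {S φ u} → Ladder T G side S φ → length S < t → u ∈ S →
                   ∃[ r ] FreshRung T G side S φ u r
      fresh-rung {S} {φ} {u} L S<t u∈ =
        let z , y′ , z∉ , y′∉ , y-z , x-y′ , z-y′ =
              square-avoiding G (map (inX ∘ φ) S) (map (inY ∘ φ) S)
                (dense _ _ (inX-side u∈) (inY-side u∈) (rung-edge u∈)) (map<t _) (map<t _)
            z∈X = trans (bipartition-flips G bip y-z) (cong not (inY-side u∈))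
        in rung z y′ (opposite (colour (φ u))) , record
          { inX-side     = z∈X
          ; inY-side     = trans (bipartition-flips G bip z-y′) (cong not z∈X)
          ; rung-edge    = z-y′
          ; to-parent    = adj-sym G y-z
          ; from-parent  = x-y′
          ; colour-flips = opposite-≢ _
          ; inX-fresh    = z∉
          ; inY-fresh    = y′∉
          }
        where
        open Ladder L
        map<t : ∀ f → length (map f S) < t
        map<t f = subst (_< t) (sym (length-map f S)) S<t

      open import Data.List.Membership.DecPropositional (_≟_ {t}) using (_∈?_)

      grow : IsTree T → ∀ k {S φ r} → t ≤ length S + k → r ∈ S → Unique S → InducedConnected T S →
             Ladder T G side S φ → ∃₂ λ S φ → (∀ v → v ∈ S) × Ladder T G side S φ
      grow (connected , acyclic) k {S} {φ} {r} bound r∈ uniq conn L with all? (_∈? S)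
      ... | yes spans = S , φ , spans , L
      ... | no ¬spans with ¬∀⟶∃¬ t _ (_∈? S) ¬spans
      ... | v , v∉ with walk-exits T (connected r v) r∈ v∉
      ... | u , w , u∈ , w∉ , u-w with k
      ...   | zero   = contradiction (subst (t ≤_) (+-identityʳ _) bound) (<⇒≱ (∉⇒length< uniq w∉))
      ...   | suc k′ =
        let _ , fresh = fresh-rung L (∉⇒length< uniq w∉) u∈
            parent = acyclic⇒unique-neighbour T acyclic conn w∉ u∈ u-w
        in grow (connected , acyclic) k′ (subst (t ≤_) (+-suc _ k′) bound) (there r∈)
             (¬Any⇒All¬ S w∉ ∷ uniq) (∷-inducedConnected T conn u∈ w∉ u-w) (graft T G side L w∉ parent fresh)

lemma4p1 : (t : ℕ) (T : Graph t) → IsTree T →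
    (n : ℕ) (G : Graph n) (side : Fin n → Bool) → IsBipartition G side → HasEdge G →
    (∀ x y → side x ≡ false → side y ≡ true → Adj G x y →
      t ≤ goodNbrs G t x y) →
    ContainsK₂□ G T
lemma4p1 zero T tree n G side bip has-edge dense =
  (λ { (_ , ()) }) , (λ { {_ , ()} }) , (λ { (_ , ()) })
lemma4p1 (suc t) T tree n G side bip (a , b , a-b) dense =
  let x , y , x∈X , y∈Y , x-y = oriented-edge {G = G} bip a-b
      S , φ , spans , L = grow bip T dense tree t {[ Fin.zero ]} {const (rung x y Fin.zero)} ≤-refl
                            (here refl) ([] ∷ []) (singleton-inducedConnected T)
                            (single-rung-ladder bip T x∈X y∈Y x-y)
  in spanning-ladder⇒K₂□ T G side spans L
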